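{- Let $N$ and $r$ be positive integers and $n\ge 1$. Then $$ \sum_{m=0}^n\ \sum_{\substack{i_1+\cdots+i_r=n-m\\ i_1,\dots,i_r\ge 0}}\frac{(-1)^{n-m}\,c_{N,m}^{(r)}}{m!\,(N+i_1)\cdots(N+i_r)}=0. $$
   Context: For positive integers $N$ and $r$, the (multiple) hypergeometric Cauchy numbers $c_{N,n}^{(r)}$ ($n\ge0$) are defined by the formal power series identity $$\frac{1}{\bigl({}_2F_1(1,N;N+1;-x)\bigr)^r}=\left(\frac{(-1)^{N-1}x^N/N}{\log(1+x)-\sum_{k=1}^{N-1}(-1)^{k-1}x^k/k}\right)^r=\sum_{n=0}^\infty c_{N,n}^{(r)}\frac{x^n}{n!},$$ where ${}_2F_1(a,b;c;z)=\sum_{n\ge0}\frac{(a)^{(n)}(b)^{(n)}}{(c)^{(n)}}\frac{z^n}{n!}$ is the Gauss hypergeometric function and $(x)^{(n)}=x(x+1)\cdots(x+n-1)$, $(x)^{(0)}=1$. -}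

module Defs where

open import Data.Nat as ℕ using (ℕ; zero; suc; _∸_; _!)

open import Data.Integer using (+_)
open import Data.Rational using (ℚ; 0ℚ; 1ℚ; _+_; _*_; -_; _/_)
open import Data.List using (List; []; _∷_; map; upTo; concatMap; zipWith; foldr)
open import Data.Vec using (Vec; []; _∷_)

⟦_⟧ : ℕ → ℚ
⟦ n ⟧ = + n / 1

-- reciprocal of a natural number as a rational (only used at nonzero arguments;
-- the value at 0 is an irrelevant junk value)
recipℕ : ℕ → ℚ
recipℕ zero    = 0ℚ
recipℕ (suc d) = + 1 / suc d

sgn : ℕ → ℚ
sgn zero    = 1ℚ
sgn (suc k) = - sgn k

sumℚ : List ℚ → ℚ
sumℚ = foldr _+_ 0ℚ

prodℚ : List ℚ → ℚ
prodℚ = foldr _*_ 1ℚ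

rising : ℕ → ℕ → ℕ
rising x zero    = 1
rising x (suc n) = rising x n ℕ.* (x ℕ.+ n)

-- Formal power series over ℚ: coefficient sequences
Series : Set
Series = ℕ → ℚ

_⊛_ : Series → Series → Series
(f ⊛ g) n = sumℚ (map (λ k → f k * g (n ∸ k)) (upTo (suc n)))

one : Series
one zero    = 1ℚ
one (suc _) = 0ℚ

_^ˢ_ : Series → ℕ → Series
f ^ˢ zero  = one
f ^ˢ suc r = f ⊛ (f ^ˢ r)

-- Reciprocal of a formal power series a with constant term a 0 = 1:
-- b 0 = 1,  b n = - Σ_{k=1}^{n} a k * b (n - k).
-- invList a n = [b n, b (n-1), ..., b 0]
invList : Series → ℕ → List ℚ
invList a zero    = 1ℚ ∷ []
invList a (suc n) =
  let bs = invList a n   -- bs[j] = b (n - j), paired with a (j + 1), j = 0..n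
  in (- sumℚ (zipWith _*_ (map (λ j → a (suc j)) (upTo (suc n))) bs)) ∷ bs

headOr : List ℚ → ℚ
headOr []      = 0ℚ
headOr (x ∷ _) = x

invSeries : Series → Series
invSeries a n = headOr (invList a n)

-- Coefficient of x^n in 2F1(a,b;c;-x) = Σ (a)^(n)(b)^(n)/(c)^(n) (-x)^n/n!
hyp2F1neg : ℕ → ℕ → ℕ → Series
hyp2F1neg a b c n =
  sgn n * (⟦ rising a n ℕ.* rising b n ⟧ * recipℕ (rising c n ℕ.* (n !)))

-- Σ_n c_{N,n}^{(r)} x^n / n! = 1 / (2F1(1,N;N+1;-x))^r
hypCauchy : ℕ → ℕ → ℕ → ℚ
hypCauchy N r n = ⟦ n ! ⟧ * invSeries (hyp2F1neg 1 N (suc N) ^ˢ r) n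

compositions : (r s : ℕ) → List (Vec ℕ r)
compositions zero zero    = [] ∷ []
compositions zero (suc s) = []
compositions (suc r) s =
  concatMap (λ i → map (i ∷_) (compositions r (s ∸ i))) (upTo (suc s))

prodShift : ℕ → {r : ℕ} → Vec ℕ r → ℕ
prodShift N []       = 1
prodShift N (i ∷ is) = (N ℕ.+ i) ℕ.* prodShift N is

{-# OPTIONS --safe #-}
-- The coefficients of ₂F₁(1,N;N+1;-x) are N (-1)^s / (N+s), so, writing
-- w(x) = Σ x^s / (N+s), the series F = ₂F₁(1,N;N+1;-x)^r equals N^r w(-x)^r, and
-- expanding the power, its coefficient of x^k is N^r (-1)^k Σ_{i₁+⋯+i_r=k} 1/((N+i₁)⋯(N+i_r)).
-- Since c_{N,m}^{(r)}/m! is the coefficient of x^m in 1/F, the sum in question is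
-- N^{-r} times the coefficient of x^n in (1/F)·F = 1, which vanishes for n ≥ 1.
module Submission where

open import Defs
open import Data.Nat using (ℕ; suc; _≤_; _∸_; _!) renaming (_*_ to _*ℕ_)
open import Data.Rational using (ℚ; 0ℚ; _*_)
open import Data.List using (map; upTo; concatMap)
open import Relation.Binary.PropositionalEquality using (_≡_)

open import Data.Nat as ℕ using (zero; z≤n; s≤s; _<_; _^_)
import Data.Nat.Properties as ℕ
open import Data.Nat.Coprimality using (1-coprimeTo) renaming (sym to coprime-sym)
import Data.Integer as ℤ
open import Data.Integer.Properties using (pos-*)
open import Data.Rational using (1ℚ; _+_; -_; mkℚ)
open import Data.Rational.Properties
open import Data.Rational.Solver using (module +-*-Solver)
open import Data.List using (List; []; _∷_; applyUpTo; zipWith; _++_; [_])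
import Data.List.Properties as List
open import Data.Vec using (Vec; []; _∷_)
open import Function using (_∘_)
open import Relation.Binary.PropositionalEquality
  using (refl; sym; trans; cong; cong₂; module ≡-Reasoning)

open +-*-Solver using (solve; _:=_; _:*_; _:+_; :-_; con)
open ≡-Reasoning

⟦⟧≡mkℚ : ∀ n → ⟦ n ⟧ ≡ mkℚ (ℤ.+ n) 0 (coprime-sym (1-coprimeTo n))
⟦⟧≡mkℚ n = normalize-coprime (coprime-sym (1-coprimeTo n))

recipℕ-suc≡mkℚ : ∀ d → recipℕ (suc d) ≡ mkℚ (ℤ.+ 1) d (1-coprimeTo (suc d))
recipℕ-suc≡mkℚ d = normalize-coprime (1-coprimeTo (suc d))

⟦⟧-* : ∀ m n → ⟦ m ⟧ * ⟦ n ⟧ ≡ ⟦ m ℕ.* n ⟧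
⟦⟧-* m n = trans (cong₂ _*_ (⟦⟧≡mkℚ m) (⟦⟧≡mkℚ n)) (/-cong (sym (pos-* m n)) refl)

⟦n⟧*recipℕn≡1 : ∀ {n} → 1 ≤ n → ⟦ n ⟧ * recipℕ n ≡ 1ℚ
⟦n⟧*recipℕn≡1 {suc d} _ =
  trans (cong₂ _*_ (⟦⟧≡mkℚ (suc d)) (recipℕ-suc≡mkℚ d)) (*-inverseʳ (mkℚ (ℤ.+ suc d) 0 (coprime-sym (1-coprimeTo (suc d)))))

recipℕ-unique : ∀ {n} q → 1 ≤ n → ⟦ n ⟧ * q ≡ 1ℚ → q ≡ recipℕ n
recipℕ-unique {n} q n≥1 nq≡1 = begin
  q                        ≡⟨ sym (*-identityʳ q) ⟩
  q * 1ℚ                   ≡⟨ cong (q *_) (sym (⟦n⟧*recipℕn≡1 n≥1)) ⟩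
  q * (⟦ n ⟧ * recipℕ n)   ≡⟨ solve 3 (λ q x y → q :* (x :* y) := (x :* q) :* y) refl q ⟦ n ⟧ (recipℕ n) ⟩
  ⟦ n ⟧ * q * recipℕ n     ≡⟨ cong (_* recipℕ n) nq≡1 ⟩
  1ℚ * recipℕ n            ≡⟨ *-identityˡ _ ⟩
  recipℕ n                 ∎

recipℕ-* : ∀ {m n} → 1 ≤ m → 1 ≤ n → recipℕ (m ℕ.* n) ≡ recipℕ m * recipℕ n
recipℕ-* {m} {n} m≥1 n≥1 = sym (recipℕ-unique _ (ℕ.*-mono-≤ m≥1 n≥1) (begin
  ⟦ m ℕ.* n ⟧ * (recipℕ m * recipℕ n)
    ≡⟨ cong (_* (recipℕ m * recipℕ n)) (sym (⟦⟧-* m n)) ⟩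
  ⟦ m ⟧ * ⟦ n ⟧ * (recipℕ m * recipℕ n)
    ≡⟨ solve 4 (λ x y u v → (x :* y) :* (u :* v) := (x :* u) :* (y :* v)) refl ⟦ m ⟧ ⟦ n ⟧ (recipℕ m) (recipℕ n) ⟩
  (⟦ m ⟧ * recipℕ m) * (⟦ n ⟧ * recipℕ n)
    ≡⟨ cong₂ _*_ (⟦n⟧*recipℕn≡1 m≥1) (⟦n⟧*recipℕn≡1 n≥1) ⟩
  1ℚ * 1ℚ
    ≡⟨ *-identityˡ 1ℚ ⟩
  1ℚ ∎))

⟦⟧*recipℕ-cong : ∀ x {y} u {v} → x ℕ.* v ≡ u ℕ.* y → 1 ≤ y → 1 ≤ v →
                 ⟦ x ⟧ * recipℕ y ≡ ⟦ u ⟧ * recipℕ v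
⟦⟧*recipℕ-cong x {y} u {v} xv≡uy y≥1 v≥1 = begin
  ⟦ x ⟧ * recipℕ y
    ≡⟨ sym (*-identityʳ _) ⟩
  ⟦ x ⟧ * recipℕ y * 1ℚ
    ≡⟨ cong (⟦ x ⟧ * recipℕ y *_) (sym (⟦n⟧*recipℕn≡1 v≥1)) ⟩
  ⟦ x ⟧ * recipℕ y * (⟦ v ⟧ * recipℕ v)
    ≡⟨ solve 4 (λ x a v b → x :* a :* (v :* b) := (x :* v) :* (a :* b)) refl ⟦ x ⟧ (recipℕ y) ⟦ v ⟧ (recipℕ v) ⟩
  (⟦ x ⟧ * ⟦ v ⟧) * (recipℕ y * recipℕ v)
    ≡⟨ cong (_* (recipℕ y * recipℕ v)) (trans (⟦⟧-* x v) (trans (cong ⟦_⟧ xv≡uy) (sym (⟦⟧-* u y)))) ⟩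
  (⟦ u ⟧ * ⟦ y ⟧) * (recipℕ y * recipℕ v)
    ≡⟨ solve 4 (λ u y a b → (u :* y) :* (a :* b) := u :* b :* (y :* a)) refl ⟦ u ⟧ ⟦ y ⟧ (recipℕ y) (recipℕ v) ⟩
  ⟦ u ⟧ * recipℕ v * (⟦ y ⟧ * recipℕ y)
    ≡⟨ cong (⟦ u ⟧ * recipℕ v *_) (⟦n⟧*recipℕn≡1 y≥1) ⟩
  ⟦ u ⟧ * recipℕ v * 1ℚ
    ≡⟨ *-identityʳ _ ⟩
  ⟦ u ⟧ * recipℕ v ∎

⟦n⟧*q≡0⇒q≡0 : ∀ {n} q → 1 ≤ n → ⟦ n ⟧ * q ≡ 0ℚ → q ≡ 0ℚ
⟦n⟧*q≡0⇒q≡0 {n} q n≥1 nq≡0 = begin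
  q                        ≡⟨ sym (*-identityˡ q) ⟩
  1ℚ * q                   ≡⟨ cong (_* q) (sym (⟦n⟧*recipℕn≡1 n≥1)) ⟩
  ⟦ n ⟧ * recipℕ n * q     ≡⟨ solve 3 (λ x y q → x :* y :* q := y :* (x :* q)) refl ⟦ n ⟧ (recipℕ n) q ⟩
  recipℕ n * (⟦ n ⟧ * q)   ≡⟨ cong (recipℕ n *_) nq≡0 ⟩
  recipℕ n * 0ℚ            ≡⟨ *-zeroʳ (recipℕ n) ⟩
  0ℚ                       ∎

sgn-+ : ∀ k s → k ≤ s → sgn k * sgn (s ∸ k) ≡ sgn s
sgn-+ zero    s       _         = *-identityˡ (sgn s)
sgn-+ (suc k) (suc s) (s≤s k≤s) =
  trans (sym (neg-distribˡ-* (sgn k) (sgn (s ∸ k)))) (cong -_ (sgn-+ k s k≤s))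

∑ : ℕ → (ℕ → ℚ) → ℚ
∑ n f = sumℚ (applyUpTo f n)

sumℚ-++ : ∀ xs ys → sumℚ (xs ++ ys) ≡ sumℚ xs + sumℚ ys
sumℚ-++ []       ys = sym (+-identityˡ _)
sumℚ-++ (x ∷ xs) ys = trans (cong (x +_) (sumℚ-++ xs ys)) (sym (+-assoc x _ _))

sumℚ-*ˡ : ∀ c xs → sumℚ (map (c *_) xs) ≡ c * sumℚ xs
sumℚ-*ˡ c []       = sym (*-zeroʳ c)
sumℚ-*ˡ c (x ∷ xs) = trans (cong (c * x +_) (sumℚ-*ˡ c xs)) (sym (*-distribˡ-+ c _ _))

sumℚ-concatMap : ∀ {A B : Set} (f : B → ℚ) (g : A → List B) xs →
                 sumℚ (map f (concatMap g xs)) ≡ sumℚ (map (λ x → sumℚ (map f (g x))) xs)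
sumℚ-concatMap f g []       = refl
sumℚ-concatMap f g (x ∷ xs) = begin
  sumℚ (map f (g x ++ concatMap g xs))
    ≡⟨ cong sumℚ (List.map-++ f (g x) (concatMap g xs)) ⟩
  sumℚ (map f (g x) ++ map f (concatMap g xs))
    ≡⟨ sumℚ-++ (map f (g x)) _ ⟩
  sumℚ (map f (g x)) + sumℚ (map f (concatMap g xs))
    ≡⟨ cong (sumℚ (map f (g x)) +_) (sumℚ-concatMap f g xs) ⟩
  sumℚ (map f (g x)) + sumℚ (map (λ x → sumℚ (map f (g x))) xs) ∎

sumℚ-map-upTo : ∀ f n → sumℚ (map f (upTo n)) ≡ ∑ n f
sumℚ-map-upTo f n = cong sumℚ (List.map-applyUpTo (λ k → k) f n)

∑-cong : ∀ n {f g : ℕ → ℚ} → (∀ k → k < n → f k ≡ g k) → ∑ n f ≡ ∑ n g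
∑-cong zero    f≡g = refl
∑-cong (suc n) f≡g = cong₂ _+_ (f≡g 0 (s≤s z≤n)) (∑-cong n (λ k k<n → f≡g (suc k) (s≤s k<n)))

∑-∷ʳ : ∀ n f → ∑ (suc n) f ≡ ∑ n f + f n
∑-∷ʳ n f = begin
  sumℚ (applyUpTo f (suc n))        ≡⟨ cong sumℚ (sym (List.applyUpTo-∷ʳ f n)) ⟩
  sumℚ (applyUpTo f n ++ [ f n ])   ≡⟨ sumℚ-++ (applyUpTo f n) [ f n ] ⟩
  ∑ n f + (f n + 0ℚ)                ≡⟨ cong (∑ n f +_) (+-identityʳ (f n)) ⟩
  ∑ n f + f n                       ∎

∑-reverse : ∀ n f → ∑ (suc n) f ≡ ∑ (suc n) (λ k → f (n ∸ k))
∑-reverse zero    f = refl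
∑-reverse (suc n) f = begin
  f 0 + ∑ (suc n) (f ∘ suc)
    ≡⟨ cong (f 0 +_) (∑-reverse n (f ∘ suc)) ⟩
  f 0 + ∑ (suc n) (λ k → f (suc (n ∸ k)))
    ≡⟨ +-comm (f 0) _ ⟩
  ∑ (suc n) (λ k → f (suc (n ∸ k))) + f 0
    ≡⟨ cong₂ _+_ (∑-cong (suc n) (λ k k<n → cong f (sym (ℕ.+-∸-assoc 1 (ℕ.≤-pred k<n)))))
                 (cong f (sym (ℕ.n∸n≡0 n))) ⟩
  ∑ (suc n) (λ k → f (suc n ∸ k)) + f (suc n ∸ suc n)
    ≡⟨ sym (∑-∷ʳ (suc n) (λ k → f (suc n ∸ k))) ⟩
  ∑ (suc (suc n)) (λ k → f (suc n ∸ k)) ∎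

∑-*ˡ : ∀ n c f → ∑ n (λ k → c * f k) ≡ c * ∑ n f
∑-*ˡ n c f = trans (cong sumℚ (sym (List.map-applyUpTo f (c *_) n))) (sumℚ-*ˡ c (applyUpTo f n))

⊛-as-∑ : ∀ f g n → (f ⊛ g) n ≡ ∑ (suc n) (λ k → f k * g (n ∸ k))
⊛-as-∑ f g n = sumℚ-map-upTo (λ k → f k * g (n ∸ k)) (suc n)

⊛-comm : ∀ f g n → (f ⊛ g) n ≡ (g ⊛ f) n
⊛-comm f g n = begin
  (f ⊛ g) n
    ≡⟨ ⊛-as-∑ f g n ⟩
  ∑ (suc n) (λ k → f k * g (n ∸ k))
    ≡⟨ ∑-reverse n (λ k → f k * g (n ∸ k)) ⟩
  ∑ (suc n) (λ k → f (n ∸ k) * g (n ∸ (n ∸ k)))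
    ≡⟨ ∑-cong (suc n) (λ k k≤n → trans (*-comm (f (n ∸ k)) (g (n ∸ (n ∸ k))))
                                       (cong (λ j → g j * f (n ∸ k)) (ℕ.m∸[m∸n]≡n (ℕ.≤-pred k≤n)))) ⟩
  ∑ (suc n) (λ k → g k * f (n ∸ k))
    ≡⟨ sym (⊛-as-∑ g f n) ⟩
  (g ⊛ f) n ∎

⊛-cong : ∀ {f f′ g g′ : Series} → (∀ k → f k ≡ f′ k) → (∀ k → g k ≡ g′ k) →
         ∀ n → (f ⊛ g) n ≡ (f′ ⊛ g′) n
⊛-cong f≡f′ g≡g′ n =
  cong sumℚ (List.map-cong (λ k → cong₂ _*_ (f≡f′ k) (g≡g′ (n ∸ k))) (upTo (suc n)))

⊛-scale : ∀ c d f g n → ((λ k → c * f k) ⊛ (λ k → d * g k)) n ≡ c * d * (f ⊛ g) n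
⊛-scale c d f g n = begin
  sumℚ (map (λ k → c * f k * (d * g (n ∸ k))) (upTo (suc n)))
    ≡⟨ cong sumℚ (List.map-cong (λ k → solve 4 (λ c d x y → c :* x :* (d :* y) := c :* d :* (x :* y))
                                                refl c d (f k) (g (n ∸ k)))
                                (upTo (suc n))) ⟩
  sumℚ (map (λ k → c * d * (f k * g (n ∸ k))) (upTo (suc n)))
    ≡⟨ cong sumℚ (List.map-∘ {g = c * d *_} {f = λ k → f k * g (n ∸ k)} (upTo (suc n))) ⟩
  sumℚ (map (c * d *_) (map (λ k → f k * g (n ∸ k)) (upTo (suc n))))
    ≡⟨ sumℚ-*ˡ (c * d) (map (λ k → f k * g (n ∸ k)) (upTo (suc n))) ⟩
  c * d * (f ⊛ g) n ∎

-- f ↦ f(-x)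
alternate : Series → Series
alternate f s = sgn s * f s

alternate-⊛ : ∀ f g n → (alternate f ⊛ alternate g) n ≡ alternate (f ⊛ g) n
alternate-⊛ f g n = begin
  (alternate f ⊛ alternate g) n
    ≡⟨ ⊛-as-∑ (alternate f) (alternate g) n ⟩
  ∑ (suc n) (λ k → sgn k * f k * (sgn (n ∸ k) * g (n ∸ k)))
    ≡⟨ ∑-cong (suc n) (λ k k≤n → regroup k (ℕ.≤-pred k≤n)) ⟩
  ∑ (suc n) (λ k → sgn n * (f k * g (n ∸ k)))
    ≡⟨ ∑-*ˡ (suc n) (sgn n) (λ k → f k * g (n ∸ k)) ⟩
  sgn n * ∑ (suc n) (λ k → f k * g (n ∸ k))
    ≡⟨ cong (sgn n *_) (sym (⊛-as-∑ f g n)) ⟩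
  alternate (f ⊛ g) n ∎
  where
  regroup : ∀ k → k ≤ n → sgn k * f k * (sgn (n ∸ k) * g (n ∸ k)) ≡ sgn n * (f k * g (n ∸ k))
  regroup k k≤n = trans
    (solve 4 (λ s x t y → s :* x :* (t :* y) := s :* t :* (x :* y)) refl (sgn k) (f k) (sgn (n ∸ k)) (g (n ∸ k)))
    (cong (_* (f k * g (n ∸ k))) (sgn-+ k n k≤n))

^ˢ-zero : ∀ f → f 0 ≡ 1ℚ → ∀ r → (f ^ˢ r) 0 ≡ 1ℚ
^ˢ-zero f f0≡1 zero    = refl
^ˢ-zero f f0≡1 (suc r) = cong₂ (λ x y → x * y + 0ℚ) f0≡1 (^ˢ-zero f f0≡1 r)

^ˢ-scale-alternate : ∀ c {f} g → (∀ s → f s ≡ ⟦ c ⟧ * alternate g s) →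
                     ∀ r s → (f ^ˢ r) s ≡ ⟦ c ^ r ⟧ * alternate (g ^ˢ r) s
^ˢ-scale-alternate c g f≡ zero zero    = refl
^ˢ-scale-alternate c g f≡ zero (suc s) = sym (trans (*-identityˡ _) (*-zeroʳ (sgn (suc s))))
^ˢ-scale-alternate c {f} g f≡ (suc r) s = begin
  (f ⊛ (f ^ˢ r)) s
    ≡⟨ ⊛-cong f≡ (^ˢ-scale-alternate c g f≡ r) s ⟩
  ((λ k → ⟦ c ⟧ * alternate g k) ⊛ (λ k → ⟦ c ^ r ⟧ * alternate (g ^ˢ r) k)) s
    ≡⟨ ⊛-scale ⟦ c ⟧ ⟦ c ^ r ⟧ (alternate g) (alternate (g ^ˢ r)) s ⟩
  ⟦ c ⟧ * ⟦ c ^ r ⟧ * (alternate g ⊛ alternate (g ^ˢ r)) s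
    ≡⟨ cong₂ _*_ (⟦⟧-* c (c ^ r)) (alternate-⊛ g (g ^ˢ r) s) ⟩
  ⟦ c ^ suc r ⟧ * alternate (g ^ˢ suc r) s ∎

zipWith-applyUpTo : ∀ {A B C : Set} (h : A → B → C) f g n →
                    zipWith h (applyUpTo f n) (applyUpTo g n) ≡ applyUpTo (λ k → h (f k) (g k)) n
zipWith-applyUpTo h f g zero    = refl
zipWith-applyUpTo h f g (suc n) = cong (h (f 0) (g 0) ∷_) (zipWith-applyUpTo h (f ∘ suc) (g ∘ suc) n)

invList≡applyUpTo : ∀ A n → invList A n ≡ applyUpTo (λ j → invSeries A (n ∸ j)) (suc n)
invList≡applyUpTo A zero    = refl
invList≡applyUpTo A (suc n) = cong (invSeries A (suc n) ∷_) (invList≡applyUpTo A n)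

invSeries-suc : ∀ A n → invSeries A (suc n) ≡ - ∑ (suc n) (λ j → A (suc j) * invSeries A (n ∸ j))
invSeries-suc A n = cong (λ xs → - sumℚ xs) (begin
  zipWith _*_ (map (A ∘ suc) (upTo (suc n))) (invList A n)
    ≡⟨ cong₂ (zipWith _*_) (List.map-applyUpTo (λ k → k) (A ∘ suc) (suc n)) (invList≡applyUpTo A n) ⟩
  zipWith _*_ (applyUpTo (A ∘ suc) (suc n)) (applyUpTo (λ j → invSeries A (n ∸ j)) (suc n))
    ≡⟨ zipWith-applyUpTo _*_ (A ∘ suc) (λ j → invSeries A (n ∸ j)) (suc n) ⟩
  applyUpTo (λ j → A (suc j) * invSeries A (n ∸ j)) (suc n) ∎)

⊛-invSeriesʳ : ∀ A → A 0 ≡ 1ℚ → ∀ n → (A ⊛ invSeries A) n ≡ one n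
⊛-invSeriesʳ A A0≡1 zero    = cong (λ a → a * 1ℚ + 0ℚ) A0≡1
⊛-invSeriesʳ A A0≡1 (suc n) = begin
  (A ⊛ b) (suc n)
    ≡⟨ ⊛-as-∑ A b (suc n) ⟩
  A 0 * b (suc n) + rest
    ≡⟨ cong₂ (λ a x → a * x + rest) A0≡1 (invSeries-suc A n) ⟩
  1ℚ * (- rest) + rest
    ≡⟨ solve 1 (λ x → con 1ℚ :* (:- x) :+ x := con 0ℚ) refl rest ⟩
  0ℚ ∎
  where
  b    = invSeries A
  rest = ∑ (suc n) (λ j → A (suc j) * b (n ∸ j))

invSeries-⊛ : ∀ A → A 0 ≡ 1ℚ → ∀ n → (invSeries A ⊛ A) n ≡ one n
invSeries-⊛ A A0≡1 n = trans (⊛-comm (invSeries A) A n) (⊛-invSeriesʳ A A0≡1 n)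

prodWith : (ℕ → ℚ) → ∀ {r} → Vec ℕ r → ℚ
prodWith w []       = 1ℚ
prodWith w (i ∷ is) = w i * prodWith w is

sumℚ-compositions : ∀ w r s → sumℚ (map (prodWith w) (compositions r s)) ≡ (w ^ˢ r) s
sumℚ-compositions w zero    zero    = refl
sumℚ-compositions w zero    (suc s) = refl
sumℚ-compositions w (suc r) s = begin
  sumℚ (map (prodWith w) (concatMap (λ i → map (i ∷_) (parts i)) (upTo (suc s))))
    ≡⟨ sumℚ-concatMap (prodWith w) (λ i → map (i ∷_) (parts i)) (upTo (suc s)) ⟩
  sumℚ (map (λ i → sumℚ (map (prodWith w) (map (i ∷_) (parts i)))) (upTo (suc s)))
    ≡⟨ cong sumℚ (List.map-cong first-part (upTo (suc s))) ⟩
  (w ⊛ (w ^ˢ r)) s ∎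
  where
  parts : ℕ → List (Vec ℕ r)
  parts i = compositions r (s ∸ i)
  first-part : ∀ i → sumℚ (map (prodWith w) (map (i ∷_) (parts i))) ≡ w i * (w ^ˢ r) (s ∸ i)
  first-part i = begin
    sumℚ (map (prodWith w) (map (i ∷_) (parts i)))
      ≡⟨ cong sumℚ (sym (List.map-∘ (parts i))) ⟩
    sumℚ (map (λ is → w i * prodWith w is) (parts i))
      ≡⟨ cong sumℚ (List.map-∘ (parts i)) ⟩
    sumℚ (map (w i *_) (map (prodWith w) (parts i)))
      ≡⟨ sumℚ-*ˡ (w i) (map (prodWith w) (parts i)) ⟩
    w i * sumℚ (map (prodWith w) (parts i))
      ≡⟨ cong (w i *_) (sumℚ-compositions w r (s ∸ i)) ⟩
    w i * (w ^ˢ r) (s ∸ i) ∎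

N+i≥1 : ∀ {N} → 1 ≤ N → ∀ i → 1 ≤ N ℕ.+ i
N+i≥1 {N} N≥1 i = ℕ.≤-trans N≥1 (ℕ.m≤m+n N i)

prodShift≥1 : ∀ {N} → 1 ≤ N → ∀ {r} (is : Vec ℕ r) → 1 ≤ prodShift N is
prodShift≥1 N≥1 []       = s≤s z≤n
prodShift≥1 N≥1 (i ∷ is) = ℕ.*-mono-≤ (N+i≥1 N≥1 i) (prodShift≥1 N≥1 is)

recipℕ-prodShift : ∀ {N} → 1 ≤ N → ∀ {r} (is : Vec ℕ r) →
                   recipℕ (prodShift N is) ≡ prodWith (λ i → recipℕ (N ℕ.+ i)) is
recipℕ-prodShift     N≥1 []       = refl
recipℕ-prodShift {N} N≥1 (i ∷ is) = trans (recipℕ-* (N+i≥1 N≥1 i) (prodShift≥1 N≥1 is))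
                                          (cong (recipℕ (N ℕ.+ i) *_) (recipℕ-prodShift N≥1 is))

rising-1 : ∀ s → rising 1 s ≡ s !
rising-1 zero    = refl
rising-1 (suc s) = trans (cong (ℕ._* suc s) (rising-1 s)) (ℕ.*-comm (s !) (suc s))

rising-*-+ : ∀ N s → rising N s ℕ.* (N ℕ.+ s) ≡ N ℕ.* rising (suc N) s
rising-*-+ N zero    = trans (ℕ.+-identityʳ (N ℕ.+ 0)) (trans (ℕ.+-identityʳ N) (sym (ℕ.*-identityʳ N)))
rising-*-+ N (suc s) = begin
  rising N s ℕ.* (N ℕ.+ s) ℕ.* (N ℕ.+ suc s)     ≡⟨ cong (ℕ._* (N ℕ.+ suc s)) (rising-*-+ N s) ⟩
  N ℕ.* rising (suc N) s ℕ.* (N ℕ.+ suc s)       ≡⟨ ℕ.*-assoc N _ _ ⟩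
  N ℕ.* (rising (suc N) s ℕ.* (N ℕ.+ suc s))     ≡⟨ cong (λ z → N ℕ.* (rising (suc N) s ℕ.* z)) (ℕ.+-suc N s) ⟩
  N ℕ.* (rising (suc N) s ℕ.* (suc N ℕ.+ s))     ∎

rising≥1 : ∀ {x} → 1 ≤ x → ∀ s → 1 ≤ rising x s
rising≥1 x≥1 zero    = s≤s z≤n
rising≥1 x≥1 (suc s) = ℕ.*-mono-≤ (rising≥1 x≥1 s) (N+i≥1 x≥1 s)

hyp2F1neg-1-N-N+1 : ∀ {N} → 1 ≤ N → ∀ s →
                    hyp2F1neg 1 N (suc N) s ≡ ⟦ N ⟧ * alternate (λ i → recipℕ (N ℕ.+ i)) s
hyp2F1neg-1-N-N+1 {N} N≥1 s = begin
  sgn s * (⟦ rising 1 s ℕ.* rising N s ⟧ * recipℕ (rising (suc N) s ℕ.* s !))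
    ≡⟨ cong (sgn s *_) (⟦⟧*recipℕ-cong (rising 1 s ℕ.* rising N s) N cross-multiplied
                          (ℕ.*-mono-≤ (rising≥1 (s≤s z≤n) s) (ℕ.1≤n! s)) (N+i≥1 N≥1 s)) ⟩
  sgn s * (⟦ N ⟧ * recipℕ (N ℕ.+ s))
    ≡⟨ solve 3 (λ g n r → g :* (n :* r) := n :* (g :* r)) refl (sgn s) ⟦ N ⟧ (recipℕ (N ℕ.+ s)) ⟩
  ⟦ N ⟧ * (sgn s * recipℕ (N ℕ.+ s)) ∎
  where
  cross-multiplied : rising 1 s ℕ.* rising N s ℕ.* (N ℕ.+ s) ≡ N ℕ.* (rising (suc N) s ℕ.* s !)
  cross-multiplied = begin
    rising 1 s ℕ.* rising N s ℕ.* (N ℕ.+ s)   ≡⟨ cong (λ z → z ℕ.* rising N s ℕ.* (N ℕ.+ s)) (rising-1 s) ⟩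
    s ! ℕ.* rising N s ℕ.* (N ℕ.+ s)          ≡⟨ ℕ.*-assoc (s !) (rising N s) _ ⟩
    s ! ℕ.* (rising N s ℕ.* (N ℕ.+ s))        ≡⟨ cong (s ! ℕ.*_) (rising-*-+ N s) ⟩
    s ! ℕ.* (N ℕ.* rising (suc N) s)          ≡⟨ ℕ.*-comm (s !) _ ⟩
    N ℕ.* rising (suc N) s ℕ.* s !            ≡⟨ ℕ.*-assoc N (rising (suc N) s) (s !) ⟩
    N ℕ.* (rising (suc N) s ℕ.* s !)          ∎

hypCauchy-term : ∀ {N} → 1 ≤ N → ∀ r m k →
  sumℚ (map (λ is → sgn k * hypCauchy N r m * recipℕ ((m !) *ℕ prodShift N is)) (compositions r k))
  ≡ invSeries (hyp2F1neg 1 N (suc N) ^ˢ r) m * alternate ((λ i → recipℕ (N ℕ.+ i)) ^ˢ r) k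
hypCauchy-term {N} N≥1 r m k = begin
  sumℚ (map (λ is → sgn k * (⟦ m ! ⟧ * b) * recipℕ ((m !) *ℕ prodShift N is)) (compositions r k))
    ≡⟨ cong sumℚ (List.map-cong summand (compositions r k)) ⟩
  sumℚ (map (λ is → sgn k * b * prodWith w is) (compositions r k))
    ≡⟨ cong sumℚ (List.map-∘ {g = sgn k * b *_} {f = prodWith w} (compositions r k)) ⟩
  sumℚ (map (sgn k * b *_) (map (prodWith w) (compositions r k)))
    ≡⟨ sumℚ-*ˡ (sgn k * b) (map (prodWith w) (compositions r k)) ⟩
  sgn k * b * sumℚ (map (prodWith w) (compositions r k))
    ≡⟨ cong (sgn k * b *_) (sumℚ-compositions w r k) ⟩
  sgn k * b * (w ^ˢ r) k
    ≡⟨ solve 3 (λ s b x → s :* b :* x := b :* (s :* x)) refl (sgn k) b ((w ^ˢ r) k) ⟩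
  b * alternate (w ^ˢ r) k ∎
  where
  w : Series
  w i = recipℕ (N ℕ.+ i)
  b : ℚ
  b = invSeries (hyp2F1neg 1 N (suc N) ^ˢ r) m
  summand : ∀ is → sgn k * (⟦ m ! ⟧ * b) * recipℕ ((m !) *ℕ prodShift N is) ≡ sgn k * b * prodWith w is
  summand is = begin
    sgn k * (⟦ m ! ⟧ * b) * recipℕ ((m !) *ℕ prodShift N is)
      ≡⟨ cong (sgn k * (⟦ m ! ⟧ * b) *_) (recipℕ-* (ℕ.1≤n! m) (prodShift≥1 N≥1 is)) ⟩
    sgn k * (⟦ m ! ⟧ * b) * (recipℕ (m !) * recipℕ (prodShift N is))
      ≡⟨ cong (λ p → sgn k * (⟦ m ! ⟧ * b) * (recipℕ (m !) * p)) (recipℕ-prodShift N≥1 is) ⟩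
    sgn k * (⟦ m ! ⟧ * b) * (recipℕ (m !) * prodWith w is)
      ≡⟨ solve 5 (λ s f b u p → s :* (f :* b) :* (u :* p) := s :* b :* p :* (f :* u))
               refl (sgn k) ⟦ m ! ⟧ b (recipℕ (m !)) (prodWith w is) ⟩
    sgn k * b * prodWith w is * (⟦ m ! ⟧ * recipℕ (m !))
      ≡⟨ cong (sgn k * b * prodWith w is *_) (⟦n⟧*recipℕn≡1 (ℕ.1≤n! m)) ⟩
    sgn k * b * prodWith w is * 1ℚ
      ≡⟨ *-identityʳ _ ⟩
    sgn k * b * prodWith w is ∎

proposition2 : (N r n : ℕ) → 1 ≤ N → 1 ≤ r → 1 ≤ n →
    sumℚ (map (λ m → sumℚ (map (λ is →
        sgn (n ∸ m) * hypCauchy N r m * recipℕ ((m !) *ℕ prodShift N is))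
      (compositions r (n ∸ m))))
      (upTo (suc n)))
    ≡ 0ℚ
-- The identity holds for r = 0 as well.
proposition2 N@(suc _) r n@(suc _) N≥1 _ _ = ⟦n⟧*q≡0⇒q≡0 _ (ℕ.m^n>0 N r) (begin
  ⟦ N ^ r ⟧ * sumℚ (map T (upTo (suc n)))
    ≡⟨ sym (sumℚ-*ˡ ⟦ N ^ r ⟧ (map T (upTo (suc n)))) ⟩
  sumℚ (map (⟦ N ^ r ⟧ *_) (map T (upTo (suc n))))
    ≡⟨ cong sumℚ (sym (List.map-∘ {g = ⟦ N ^ r ⟧ *_} {f = T} (upTo (suc n)))) ⟩
  sumℚ (map (λ m → ⟦ N ^ r ⟧ * T m) (upTo (suc n)))
    ≡⟨ cong sumℚ (List.map-cong scaled-term (upTo (suc n))) ⟩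
  (invSeries F ⊛ F) n
    ≡⟨ invSeries-⊛ F (^ˢ-zero a refl r) n ⟩
  0ℚ ∎)
  where
  a : Series
  a = hyp2F1neg 1 N (suc N)
  F : Series
  F = a ^ˢ r
  w : Series
  w i = recipℕ (N ℕ.+ i)
  T : ℕ → ℚ
  T m = sumℚ (map (λ is → sgn (n ∸ m) * hypCauchy N r m * recipℕ ((m !) *ℕ prodShift N is))
                  (compositions r (n ∸ m)))
  scaled-term : ∀ m → ⟦ N ^ r ⟧ * T m ≡ invSeries F m * F (n ∸ m)
  scaled-term m = begin
    ⟦ N ^ r ⟧ * T m
      ≡⟨ cong (⟦ N ^ r ⟧ *_) (hypCauchy-term N≥1 r m (n ∸ m)) ⟩
    ⟦ N ^ r ⟧ * (invSeries F m * alternate (w ^ˢ r) (n ∸ m))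
      ≡⟨ solve 3 (λ c b x → c :* (b :* x) := b :* (c :* x)) refl ⟦ N ^ r ⟧ (invSeries F m) (alternate (w ^ˢ r) (n ∸ m)) ⟩
    invSeries F m * (⟦ N ^ r ⟧ * alternate (w ^ˢ r) (n ∸ m))
      ≡⟨ cong (invSeries F m *_) (sym (^ˢ-scale-alternate N w (hyp2F1neg-1-N-N+1 N≥1) r (n ∸ m))) ⟩
    invSeries F m * F (n ∸ m) ∎
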